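{- For every $n$PC formula $F$ and all $i,j,k\in\{1,\dots,n\}$: (i) if $i\neq j$ then $\mathsf e_i\vdash_j$ (empty right-hand side) is provable; (ii) $F\vdash_i F$ is provable; (iii) if $i\neq k$ then $F^{(ij)},F^{(kj)}\vdash_j$ (empty right-hand side) is provable.
   Context: Fix $n\ge 2$, write $\hat n=\{1,\dots,n\}$, let $S_n$ be the group of permutations of $\hat n$ and $V$ a countable set of propositional variables. Formulas of $n$PC are: decorated variables $X^\pi$ ($X\in V$, $\pi\in S_n$); constants $\mathsf e_1,\dots,\mathsf e_n$; compound formulas $q(F,G_1,\dots,G_n)$. For $\rho\in S_n$, $F^\rho$ is defined by $(X^\pi)^\rho=X^{\rho\circ\pi}$, $(\mathsf e_k)^\rho=\mathsf e_{\rho(k)}$, $q(F,G_1,\dots,G_n)^\rho=q(F,G_1^\rho,\dots,G_n^\rho)$. $(ij)$ denotes the transposition exchanging $i$ and $j$ (identity if $i=j$). Contexts $\Gamma,\Delta$ are finite multisets of formulas, $\Gamma^\rho$ elementwise. Sequents $\Gamma\vdash_i\Delta$ ($i\in\hat n$) are provable if derivable by the rules (premises $\Rightarrow$ conclusion), for all $i,j,k\in\hat n$: (Const) $\Rightarrow\ \vdash_i\mathsf e_i$. (Id) $\Rightarrow X^\pi\vdash_i X^\rho$ whenever $\pi^{ -1}(i)=\rho^{ -1}(i)$. (Sym) $\Gamma^{(ij)}\vdash_i\Delta^{(ij)}\Rightarrow\Gamma\vdash_j\Delta$. (Neg1) if $i\ne k$: $\Gamma^{(ij)}\vdash_i F,\Delta^{(ij)}\Rightarrow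 \Gamma,F^{(jk)}\vdash_j\Delta$. (Neg2) if $j\neq k$: $\Gamma^{(ij)}\vdash_i F,\Delta^{(ij)}\Rightarrow \Gamma,F^{(ik)}\vdash_j\Delta$. (Neg3) $\{\Gamma^{(ij)},F\vdash_i\Delta^{(ij)}\}_{i\neq j}\Rightarrow\Gamma\vdash_j F,\Delta$. (qL) $\{\Gamma^{(ji)},F,G_j^{(ji)}\vdash_j\Delta^{(ji)}\}_{j\in\hat n}\Rightarrow \Gamma,q(F,G_1,\dots,G_n)\vdash_i\Delta$. (qR) $\{\Gamma^{(ji)},F\vdash_j G_j^{(ji)},\Delta^{(ji)}\}_{j\in\hat n}\Rightarrow\Gamma\vdash_i q(F,G_1,\dots,G_n),\Delta$. (Cut) $\Gamma,F\vdash_i\Delta$ and $\Gamma\vdash_i F,\Delta\Rightarrow\Gamma\vdash_i\Delta$. Left and right weakening and contraction in each $\vdash_i$. -}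

module Defs where

open import Data.Nat using (ℕ)
open import Data.Fin using (Fin)
open import Data.Fin.Permutation using (Permutation′; _⟨$⟩ʳ_; _⟨$⟩ˡ_; _∘ₚ_; transpose)
open import Data.List using (List; []; _∷_; map)
open import Data.List.Relation.Binary.Permutation.Propositional using (_↭_)
open import Relation.Binary.PropositionalEquality using (_≡_; _≢_)

-- The calculus nPC, for a fixed n (the hypothesis n ≥ 2 is imposed in the statement).
module NPC (n : ℕ) where

  Perm : Set
  Perm = Permutation′ n

  -- (ij) : the transposition exchanging i and j (identity when i = j).
  tr : Fin n → Fin n → Perm
  tr i j = transpose i j

  Var : Set
  Var = ℕ

  data Formula : Set where
    var : Var → Perm → Formula
    e   : Fin n → Formula
    q   : Formula → (Fin n → Formula) → Formula

  -- F^ρ.  Note: ρ ∘ π (first π, then ρ) is  π ∘ₚ ρ  in the stdlib convention.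
  _^_ : Formula → Perm → Formula
  var X π ^ ρ = var X (π ∘ₚ ρ)
  e k     ^ ρ = e (ρ ⟨$⟩ʳ k)
  q F G   ^ ρ = q F (λ j → G j ^ ρ)

  -- Contexts: finite multisets, represented as lists up to permutation
  -- (the Exchange rules below make the order irrelevant).
  Ctx : Set
  Ctx = List Formula

  _^ᶜ_ : Ctx → Perm → Ctx
  Γ ^ᶜ ρ = map (λ F → F ^ ρ) Γ

  data _⊢[_]_ : Ctx → Fin n → Ctx → Set where
    const : ∀ {i} → [] ⊢[ i ] (e i ∷ [])
    idax  : ∀ {i X π ρ} → (π ⟨$⟩ˡ i) ≡ (ρ ⟨$⟩ˡ i) →
            (var X π ∷ []) ⊢[ i ] (var X ρ ∷ [])
    sym   : ∀ {i j Γ Δ} →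
            (Γ ^ᶜ tr i j) ⊢[ i ] (Δ ^ᶜ tr i j) →
            Γ ⊢[ j ] Δ
    neg1  : ∀ {i j k Γ Δ F} → i ≢ k →
            (Γ ^ᶜ tr i j) ⊢[ i ] (F ∷ (Δ ^ᶜ tr i j)) →
            ((F ^ tr j k) ∷ Γ) ⊢[ j ] Δ
    neg2  : ∀ {i j k Γ Δ F} → j ≢ k →
            (Γ ^ᶜ tr i j) ⊢[ i ] (F ∷ (Δ ^ᶜ tr i j)) →
            ((F ^ tr i k) ∷ Γ) ⊢[ j ] Δ
    neg3  : ∀ {j Γ Δ F} →
            (∀ i → i ≢ j → (F ∷ (Γ ^ᶜ tr i j)) ⊢[ i ] (Δ ^ᶜ tr i j)) →
            Γ ⊢[ j ] (F ∷ Δ)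
    qL    : ∀ {i Γ Δ F G} →
            (∀ j → ((G j ^ tr j i) ∷ F ∷ (Γ ^ᶜ tr j i)) ⊢[ j ] (Δ ^ᶜ tr j i)) →
            (q F G ∷ Γ) ⊢[ i ] Δ
    qR    : ∀ {i Γ Δ F G} →
            (∀ j → (F ∷ (Γ ^ᶜ tr j i)) ⊢[ j ] ((G j ^ tr j i) ∷ (Δ ^ᶜ tr j i))) →
            Γ ⊢[ i ] (q F G ∷ Δ)
    cut   : ∀ {i Γ Δ F} →
            (F ∷ Γ) ⊢[ i ] Δ → Γ ⊢[ i ] (F ∷ Δ) → Γ ⊢[ i ] Δ
    weakL : ∀ {i Γ Δ F} → Γ ⊢[ i ] Δ → (F ∷ Γ) ⊢[ i ] Δ
    weakR : ∀ {i Γ Δ F} → Γ ⊢[ i ] Δ → Γ ⊢[ i ] (F ∷ Δ)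
    contrL : ∀ {i Γ Δ F} → (F ∷ F ∷ Γ) ⊢[ i ] Δ → (F ∷ Γ) ⊢[ i ] Δ
    contrR : ∀ {i Γ Δ F} → Γ ⊢[ i ] (F ∷ F ∷ Δ) → Γ ⊢[ i ] (F ∷ Δ)
    exchL : ∀ {i Γ Γ′ Δ} → Γ ↭ Γ′ → Γ ⊢[ i ] Δ → Γ′ ⊢[ i ] Δ
    exchR : ∀ {i Γ Δ Δ′} → Δ ↭ Δ′ → Γ ⊢[ i ] Δ → Γ ⊢[ i ] Δ′

module Submission where

open import Defs
open import Data.Nat using (ℕ; _≤_)
open import Data.Fin using (Fin)
open import Data.Fin.Properties using (_≟_)
open import Data.Fin.Permutation as Perm using (_≈_; _⟨$⟩ʳ_; _⟨$⟩ˡ_; _∘ₚ_; inverseˡ; inverseʳ)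
open import Data.Fin.Permutation.Components using (transpose)
open import Data.List using ([]; _∷_)
open import Data.List.Relation.Binary.Permutation.Propositional using (↭-refl; ↭-swap; ↭-trans; ↭-prep)
open import Data.Product using (_×_; _,_)
open import Data.Empty using (⊥-elim)
open import Relation.Nullary using (Dec; yes; no)
open import Relation.Binary.PropositionalEquality using (_≡_; _≢_; refl; sym; trans; cong; subst; ≢-sym)

-- Identity on q(F, G) is qR followed by qL: the diagonal premise j = l is the identity on
-- G_j (under the trivial decoration (jj)), and every off-diagonal premise is closed by Neg1
-- from the identity on F.  Decorations only compose up to pointwise equality of
-- permutations, so the identity is proved between formulas that agree up to such
-- equalities, by recursion on their common undecorated shape.  Claim (iii) is Neg2 applied
-- to the identity on (F^(kj))^(ij), followed by a cut with the identity on F^(ij), using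
-- (ik)(ij)(kj) = (ij).

module _ {n : ℕ} where

  transpose-matchˡ : (i j : Fin n) → transpose i j i ≡ j
  transpose-matchˡ i j with i ≟ i
  ... | yes _ = refl
  ... | no i≢i = ⊥-elim (i≢i refl)

  transpose-matchʳ : (i j : Fin n) → transpose i j j ≡ i
  transpose-matchʳ i j with j ≟ i
  ... | yes j≡i = j≡i
  ... | no _ with j ≟ j
  ...   | yes _ = refl
  ...   | no j≢j = ⊥-elim (j≢j refl)

  transpose-mismatch : (i j x : Fin n) → x ≢ i → x ≢ j → transpose i j x ≡ x
  transpose-mismatch i j x x≢i x≢j with x ≟ i
  ... | yes x≡i = ⊥-elim (x≢i x≡i)
  ... | no _ with x ≟ j
  ...   | yes x≡j = ⊥-elim (x≢j x≡j)
  ...   | no _ = refl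

  transpose-diagonal : (i x : Fin n) → transpose i i x ≡ x
  transpose-diagonal i x with x ≟ i
  ... | yes x≡i = sym x≡i
  ... | no _ with x ≟ i
  ...   | yes x≡i = sym x≡i
  ...   | no _ = refl

  transpose-conjugate : (i j k x : Fin n) → j ≢ k → i ≢ k →
                        transpose i k (transpose i j (transpose k j x)) ≡ transpose i j x
  transpose-conjugate i j k x j≢k i≢k = by-cases (x ≟ k) (x ≟ j) (x ≟ i)
    where
    by-cases : Dec (x ≡ k) → Dec (x ≡ j) → Dec (x ≡ i) →
               transpose i k (transpose i j (transpose k j x)) ≡ transpose i j x
    by-cases (yes refl) _ _
      rewrite transpose-matchˡ x j | transpose-matchʳ i j | transpose-matchˡ i x
            | transpose-mismatch i j x (≢-sym i≢k) (≢-sym j≢k) = refl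
    by-cases (no _) (yes refl) _
      rewrite transpose-matchʳ k x | transpose-mismatch i x k (≢-sym i≢k) (≢-sym j≢k)
            | transpose-matchʳ i k | transpose-matchʳ i x = refl
    by-cases (no x≢k) (no x≢j) (yes refl)
      rewrite transpose-mismatch k j x x≢k x≢j | transpose-matchˡ x j
            | transpose-mismatch x k j (≢-sym x≢j) j≢k = refl
    by-cases (no x≢k) (no x≢j) (no x≢i)
      rewrite transpose-mismatch k j x x≢k x≢j | transpose-mismatch i j x x≢i x≢j
            | transpose-mismatch i k x x≢i x≢k = refl

  ≈-inverse : {π ρ : Perm.Permutation′ n} → π ≈ ρ → ∀ y → π ⟨$⟩ˡ y ≡ ρ ⟨$⟩ˡ y
  ≈-inverse {π} {ρ} π≈ρ y = trans (cong (π ⟨$⟩ˡ_) (trans (sym (inverseʳ ρ)) (sym (π≈ρ _))))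
                                  (inverseˡ π)

module _ (n : ℕ) where
  open NPC n hiding (sym)

  -- Permutation′ n has no useful propositional equality (it carries functions), so formulas
  -- are compared with their decorations up to Perm._≈_.
  infix 4 _≈ᶠ_
  data _≈ᶠ_ : Formula → Formula → Set where
    var : ∀ {X π ρ} → π ≈ ρ → var X π ≈ᶠ var X ρ
    e   : ∀ {a b} → a ≡ b → e a ≈ᶠ e b
    q   : ∀ {F F′ G G′} → F ≈ᶠ F′ → (∀ j → G j ≈ᶠ G′ j) → q F G ≈ᶠ q F′ G′

  ≈ᶠ-refl : ∀ F → F ≈ᶠ F
  ≈ᶠ-refl (var X π) = var (λ _ → refl)
  ≈ᶠ-refl (e k)     = e refl
  ≈ᶠ-refl (q F G)   = q (≈ᶠ-refl F) (λ j → ≈ᶠ-refl (G j))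

  ≈ᶠ-sym : ∀ {F F′} → F ≈ᶠ F′ → F′ ≈ᶠ F
  ≈ᶠ-sym (var π≈ρ)  = var (λ x → sym (π≈ρ x))
  ≈ᶠ-sym (e a≡b)    = e (sym a≡b)
  ≈ᶠ-sym (q F≈ G≈)  = q (≈ᶠ-sym F≈) (λ j → ≈ᶠ-sym (G≈ j))

  ≈ᶠ-trans : ∀ {F F′ F″} → F ≈ᶠ F′ → F′ ≈ᶠ F″ → F ≈ᶠ F″
  ≈ᶠ-trans (var p) (var p′)   = var (λ x → trans (p x) (p′ x))
  ≈ᶠ-trans (e p)   (e p′)     = e (trans p p′)
  ≈ᶠ-trans (q p ps) (q p′ ps′) = q (≈ᶠ-trans p p′) (λ j → ≈ᶠ-trans (ps j) (ps′ j))

  ^-cong : ∀ {F F′ ρ σ} → F ≈ᶠ F′ → ρ ≈ σ → (F ^ ρ) ≈ᶠ (F′ ^ σ)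
  ^-cong {ρ = ρ} (var π≈π′) ρ≈σ = var (λ x → trans (cong (ρ ⟨$⟩ʳ_) (π≈π′ x)) (ρ≈σ _))
  ^-cong {ρ = ρ} (e a≡b)    ρ≈σ = e (trans (cong (ρ ⟨$⟩ʳ_) a≡b) (ρ≈σ _))
  ^-cong (q F≈ G≈) ρ≈σ = q F≈ (λ j → ^-cong (G≈ j) ρ≈σ)

  ^-identity : ∀ F {ρ} → ρ ≈ Perm.id → (F ^ ρ) ≈ᶠ F
  ^-identity (var X π) ρ≈id = var (λ _ → ρ≈id _)
  ^-identity (e k)     ρ≈id = e (ρ≈id k)
  ^-identity (q F G)   ρ≈id = q (≈ᶠ-refl F) (λ j → ^-identity (G j) ρ≈id)

  ^-∘ : ∀ F ρ σ → ((F ^ ρ) ^ σ) ≈ᶠ (F ^ (ρ ∘ₚ σ))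
  ^-∘ (var X π) ρ σ = var (λ _ → refl)
  ^-∘ (e k)     ρ σ = e refl
  ^-∘ (q F G)   ρ σ = q (≈ᶠ-refl F) (λ j → ^-∘ (G j) ρ σ)

  data SameShape : Formula → Formula → Set where
    var : ∀ {X π ρ} → SameShape (var X π) (var X ρ)
    e   : ∀ {a b} → SameShape (e a) (e b)
    q   : ∀ {F F′ G G′} → SameShape F F′ → (∀ j → SameShape (G j) (G′ j)) →
          SameShape (q F G) (q F′ G′)

  SameShape-refl : ∀ F → SameShape F F
  SameShape-refl (var _ _) = var
  SameShape-refl (e _)     = e
  SameShape-refl (q F G)   = q (SameShape-refl F) (λ j → SameShape-refl (G j))

  SameShape-^ : ∀ {F H} ρ → SameShape F H → SameShape F (H ^ ρ)
  SameShape-^ ρ var        = var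
  SameShape-^ ρ e          = e
  SameShape-^ ρ (q F∼ G∼)  = q F∼ (λ j → SameShape-^ ρ (G∼ j))

  e⊢∅ : ∀ {a j} → a ≢ j → (e a ∷ []) ⊢[ j ] []
  e⊢∅ {a} {j} a≢j = subst (λ b → (e b ∷ []) ⊢[ j ] []) (transpose-diagonal j a)
                          (neg1 {k = j} {Γ = []} {Δ = []} a≢j const)

  -- Recursion on the shape F: the formulas H, H′ change under decorations in the q case.
  ≈ᶠ⇒⊢-shaped : ∀ F {H H′} → SameShape F H → H ≈ᶠ H′ → ∀ i → (H ∷ []) ⊢[ i ] (H′ ∷ [])
  ≈ᶠ⇒⊢-shaped (var _ _) var (var {π = π} {ρ} π≈ρ) i = idax (≈-inverse {π = π} {ρ} π≈ρ i)
  ≈ᶠ⇒⊢-shaped (e k) e (e {a} refl) i with a ≟ i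
  ... | yes refl = weakL const
  ... | no a≢i   = weakR (e⊢∅ a≢i)
  ≈ᶠ⇒⊢-shaped (q F G) (q F∼ G∼) (q {A} {A′} {B} {B′} A≈A′ B≈B′) i =
    qR {Γ = q A B ∷ []} {Δ = []} λ j →
      exchL (↭-swap _ _ ↭-refl) (qL {Γ = A′ ∷ []} {Δ = (B′ j ^ tr j i) ∷ []} (premise j))
    where
    premise : ∀ j l → (((B l ^ tr j i) ^ tr l j) ∷ A ∷ (A′ ^ tr l j) ∷ [])
                        ⊢[ l ] (((B′ j ^ tr j i) ^ tr l j) ∷ [])
    premise j l with l ≟ j
    ... | yes refl =
      exchL (↭-trans (↭-prep _ (↭-swap _ _ ↭-refl)) (↭-swap _ _ ↭-refl))
        (weakL (weakL (≈ᶠ⇒⊢-shaped (G l) (SameShape-^ _ (SameShape-^ _ (G∼ l)))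
                         (^-cong (^-cong (B≈B′ l) (λ _ → refl)) (λ _ → refl)) l)))
    ... | no l≢j =
      weakR (weakL (exchL (↭-swap _ _ ↭-refl)
        (neg1 {k = j} {Γ = A ∷ []} {Δ = []} l≢j
          (≈ᶠ⇒⊢-shaped F (SameShape-^ _ F∼)
             (≈ᶠ-trans (^-identity A (transpose-diagonal l)) A≈A′) l))))

  ≈ᶠ⇒⊢ : ∀ {H H′} → H ≈ᶠ H′ → ∀ i → (H ∷ []) ⊢[ i ] (H′ ∷ [])
  ≈ᶠ⇒⊢ {H} = ≈ᶠ⇒⊢-shaped H (SameShape-refl H)

  cut-head : ∀ {H H′ G j} → (H ∷ []) ⊢[ j ] (H′ ∷ []) → (H′ ∷ G ∷ []) ⊢[ j ] [] →
             (H ∷ G ∷ []) ⊢[ j ] []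
  cut-head H⊢H′ H′G⊢ =
    cut (exchL (↭-swap _ _ ↭-refl) (weakL H′G⊢)) (exchL (↭-swap _ _ ↭-refl) (weakL H⊢H′))

  transposed-pair⊢∅ : ∀ F (i j k : Fin n) → j ≢ k → i ≢ k →
                      ((F ^ tr i j) ∷ (F ^ tr k j) ∷ []) ⊢[ j ] []
  transposed-pair⊢∅ F i j k j≢k i≢k = cut-head (≈ᶠ⇒⊢ conjugate j) neg2-on-identity
    where
    neg2-on-identity : ((((F ^ tr k j) ^ tr i j) ^ tr i k) ∷ (F ^ tr k j) ∷ []) ⊢[ j ] []
    neg2-on-identity = neg2 {Γ = (F ^ tr k j) ∷ []} {Δ = []} j≢k (≈ᶠ⇒⊢ (≈ᶠ-refl _) i)

    conjugate : (F ^ tr i j) ≈ᶠ (((F ^ tr k j) ^ tr i j) ^ tr i k)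
    conjugate = ≈ᶠ-sym (≈ᶠ-trans (^-cong (^-∘ F (tr k j) (tr i j)) (λ _ → refl))
                       (≈ᶠ-trans (^-∘ F (tr k j ∘ₚ tr i j) (tr i k))
                                 (^-cong (≈ᶠ-refl F) (λ x → transpose-conjugate i j k x j≢k i≢k))))

  pair⊢∅ : ∀ F (i j k : Fin n) → i ≢ k → ((F ^ tr i j) ∷ (F ^ tr k j) ∷ []) ⊢[ j ] []
  pair⊢∅ F i j k i≢k with j ≟ k
  ... | no j≢k   = transposed-pair⊢∅ F i j k j≢k i≢k
  ... | yes refl = exchL (↭-swap _ _ ↭-refl)
                     (transposed-pair⊢∅ F j j i (≢-sym i≢k) (≢-sym i≢k))

lemma3p5 : (n : ℕ) → 2 ≤ n → let open NPC n in
    (F : Formula) (i j k : Fin n) →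
    (i ≢ j → (e i ∷ []) ⊢[ j ] [])
    × ((F ∷ []) ⊢[ i ] (F ∷ []))
    × (i ≢ k → ((F ^ tr i j) ∷ (F ^ tr k j) ∷ []) ⊢[ j ] [])
lemma3p5 n _ F i j k = e⊢∅ n , ≈ᶠ⇒⊢ n (≈ᶠ-refl n F) i , pair⊢∅ n F i j k
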